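{- Let $n\ge 3$ be an integer and let $K_n$ be the complete graph on vertex set $\{1,\dots,n\}$. Then \[\gamma(F_2(K_n)) = \left\lfloor \frac{n}{2}\right\rfloor.\]
   Context: For a simple graph $G$ and an integer $k$ with $1 \le k \le |V(G)|-1$, the $k$-token graph $F_k(G)$ is the graph whose vertices are the $k$-element subsets of $V(G)$, two of them being adjacent if and only if their symmetric difference is a pair $\{u,v\}$ with $uv$ an edge of $G$. (Thus $F_k(K_n)$ is the Johnson graph $J(n,k)$: $k$-subsets of $\{1,\dots,n\}$, adjacent when they share exactly $k-1$ elements.) A dominating set of a graph $H$ is a set $D\subseteq V(H)$ such that every vertex of $H$ is in $D$ or has a neighbor in $D$; the domination number $\gamma(H)$ is the minimum size of a dominating set. -}

module Defs where

open import Data.Nat using (ℕ)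
open import Data.Fin using (Fin)
open import Data.Fin.Subset using (Subset; _∈_; _∉_; ∣_∣)
open import Data.List using (List; length)
open import Data.List.Relation.Unary.Any using (Any)
open import Data.Product using (Σ; ∃-syntax; _×_; _,_; proj₁)
open import Data.Sum using (_⊎_)
open import Relation.Binary.PropositionalEquality using (_≡_; refl; sym)
open import Relation.Nullary using (¬_)
open import Function.Bundles using (_⇔_)

record SimpleGraph (n : ℕ) : Set₁ where
  field
    Adj     : Fin n → Fin n → Set
    symm    : ∀ {u v} → Adj u v → Adj v u
    irrefl  : ∀ {u} → ¬ Adj u u
open SimpleGraph public

-- The complete graph K_n on Fin n (vertices 0..n-1 stand for 1..n).
complete : (n : ℕ) → SimpleGraph n
complete n = record
  { Adj = λ u v → ¬ (u ≡ v)
  ; symm = λ p q → p (sym q)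
  ; irrefl = λ p → p refl
  }

TokenVertex : ℕ → ℕ → Set
TokenVertex n k = Σ (Subset n) (λ A → ∣ A ∣ ≡ k)

-- Adjacency in F_k(G): the symmetric difference of A and B is {u, v} with uv ∈ E(G).
-- (As |A| = |B|, one of u, v lies in A∖B and the other in B∖A.)
TokenAdj : ∀ {n} (G : SimpleGraph n) (k : ℕ) → TokenVertex n k → TokenVertex n k → Set
TokenAdj {n} G k (A , _) (B , _) =
  ∃[ u ] ∃[ v ] (Adj G u v × u ∈ A × u ∉ B × v ∈ B × v ∉ A ×
    (∀ (w : Fin n) → ¬ (w ≡ u) → ¬ (w ≡ v) → (w ∈ A ⇔ w ∈ B)))

Dominating : ∀ {n} (G : SimpleGraph n) (k : ℕ) → List (TokenVertex n k) → Set
Dominating {n} G k D =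
  ∀ (X : TokenVertex n k) → Any (λ Y → proj₁ X ≡ proj₁ Y ⊎ TokenAdj G k Y X) D

-- γ(F_k(G)) = m : some dominating set has m elements and every dominating set has ≥ m.
-- (Lists may repeat entries; this does not affect the minimum.)
DominationNumberIs : ∀ {n} (G : SimpleGraph n) (k : ℕ) → ℕ → Set
DominationNumberIs {n} G k m =
  (Σ (List (TokenVertex n k)) (λ D → Dominating G k D × length D ≡ m)) ×
  (∀ (D : List (TokenVertex n k)) → Dominating G k D → m Data.Nat.≤ length D)

{-# OPTIONS --safe #-}
-- In F₂(Kₙ) a pair dominates exactly the pairs it meets.  The ⌊n/2⌋ disjoint pairs
-- {0,1}, {2,3}, … therefore dominate, since their union misses at most one vertex
-- and every pair has two.  Conversely, the union of a dominating family D has at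
-- most 2|D| vertices and must miss at most one vertex, for two missed vertices
-- would form an undominated pair; hence n ≤ 2|D| + 1.
module Submission where

open import Defs
open import Data.Nat using (ℕ; zero; suc; _+_; _*_; _≤_; _<_; _/_; z≤n; s≤s; s≤s⁻¹)
open import Data.Nat.Properties
  using (≤-reflexive; ≤-trans; +-suc; +-mono-≤; +-monoʳ-≤; n≤1+n; *-suc; *-comm; m+n≤o⇒m≤o∸n; ≮⇒≥)
import Data.Nat.Properties as ℕ
open import Data.Nat.DivMod using (m/n≡1+[m∸n]/n; m<n*o⇒m/o<n)
open import Data.Empty using (⊥-elim)
open import Data.Fin using (Fin; zero; suc; _≟_)
open import Data.Fin.Properties using (suc-injective)
open import Data.Fin.Subset using (Subset; _∈_; _∉_; _⊆_; ∣_∣; ⊥; ⁅_⁆; _∩_; _∪_; ⋃; Nonempty; inside; outside)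
open import Data.Fin.Subset.Properties
  using (∣⊥∣≡0; ∣p∣≤n; x∈⁅y⁆⇔x≡y; ∪⇔⊎; x∈p∩q⁺; x∈p∩q⁻; p⊆p∪q; q⊆p∪q; ⊆-antisym; x∈∁p⇒x∉p; ∣∁p∣≡n∸∣p∣)
open import Data.Vec using ([]; _∷_; here; there)
open import Data.List using (List; []; _∷_; length; map)
open import Data.List.Properties using (length-map)
open import Data.List.Relation.Unary.Any using (Any; here; there)
import Data.List.Relation.Unary.Any as Any
open import Data.List.Relation.Unary.Any.Properties using (map⁺)
open import Data.Product using (∃-syntax; _×_; _,_; proj₁)
open import Data.Sum using (_⊎_; inj₁; inj₂; [_,_])
import Data.Sum as Sum
open import Function using (_∘_; id)
open import Function.Bundles using (_⇔_; mk⇔; Equivalence)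
open import Relation.Binary.PropositionalEquality using (_≡_; _≢_; refl; sym; trans; cong; subst)
open import Relation.Nullary using (¬_; yes; no; contradiction)

open Equivalence using (to; from)

private
  variable
    n k : ℕ
    p : Subset n
    x y z : Fin n

0<∣p∣⇒Nonempty : 0 < ∣ p ∣ → Nonempty p
0<∣p∣⇒Nonempty {p = inside ∷ p}  _  = zero , here
0<∣p∣⇒Nonempty {p = outside ∷ p} 0<∣p∣ with 0<∣p∣⇒Nonempty 0<∣p∣
... | x , x∈p = suc x , there x∈p

∣p∣≡0⇒x∉p : ∣ p ∣ ≡ 0 → x ∉ p
∣p∣≡0⇒x∉p {p = outside ∷ p} ∣p∣≡0 (there x∈p) = ∣p∣≡0⇒x∉p ∣p∣≡0 x∈p

∣p∣≡1⇒singleton : ∣ p ∣ ≡ 1 → ∃[ x ] x ∈ p × (∀ y → y ∈ p → y ≡ x)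
∣p∣≡1⇒singleton {p = inside ∷ p} ∣p∣≡1 = zero , here , λ
  { zero    _              → refl
  ; (suc y) (there y∈p)    → contradiction y∈p (∣p∣≡0⇒x∉p (ℕ.suc-injective ∣p∣≡1))
  }
∣p∣≡1⇒singleton {p = outside ∷ p} ∣p∣≡1 with ∣p∣≡1⇒singleton ∣p∣≡1
... | x , x∈p , unique = suc x , there x∈p , λ { (suc y) (there y∈p) → cong suc (unique y y∈p) }

∣p∣≡2⇒other : ∣ p ∣ ≡ 2 → x ∈ p → ∃[ y ] y ≢ x × y ∈ p × (∀ z → z ∈ p → z ≡ x ⊎ z ≡ y)
∣p∣≡2⇒other {p = inside ∷ p} {zero} ∣p∣≡2 here with ∣p∣≡1⇒singleton (ℕ.suc-injective ∣p∣≡2)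
... | y , y∈p , unique = suc y , (λ ()) , there y∈p , λ
  { zero    _           → inj₁ refl
  ; (suc z) (there z∈p) → inj₂ (cong suc (unique z z∈p))
  }
∣p∣≡2⇒other {p = inside ∷ p} {suc x} ∣p∣≡2 (there x∈p) with ∣p∣≡1⇒singleton (ℕ.suc-injective ∣p∣≡2)
... | _ , _ , unique = zero , (λ ()) , here , λ
  { zero    _           → inj₂ refl
  ; (suc z) (there z∈p) → inj₁ (cong suc (trans (unique z z∈p) (sym (unique x x∈p))))
  }
∣p∣≡2⇒other {p = outside ∷ p} {suc x} ∣p∣≡2 (there x∈p) with ∣p∣≡2⇒other ∣p∣≡2 x∈p
... | y , y≢x , y∈p , cases = suc y , y≢x ∘ suc-injective , there y∈p , λ
  { (suc z) (there z∈p) → Sum.map (cong suc) (cong suc) (cases z z∈p) }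

x∈⁅y⁆∪⁅z⁆⇔ : x ∈ ⁅ y ⁆ ∪ ⁅ z ⁆ ⇔ (x ≡ y ⊎ x ≡ z)
x∈⁅y⁆∪⁅z⁆⇔ = mk⇔
  (Sum.map (to x∈⁅y⁆⇔x≡y) (to x∈⁅y⁆⇔x≡y) ∘ to ∪⇔⊎)
  (from ∪⇔⊎ ∘ Sum.map (from x∈⁅y⁆⇔x≡y) (from x∈⁅y⁆⇔x≡y))

∣p∣≡2⇒p≡⁅x⁆∪⁅y⁆ : ∣ p ∣ ≡ 2 → x ∈ p → ∃[ y ] y ≢ x × p ≡ ⁅ x ⁆ ∪ ⁅ y ⁆
∣p∣≡2⇒p≡⁅x⁆∪⁅y⁆ ∣p∣≡2 x∈p with ∣p∣≡2⇒other ∣p∣≡2 x∈p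
... | y , y≢x , y∈p , cases =
  y , y≢x , ⊆-antisym (λ {z} z∈p → from x∈⁅y⁆∪⁅z⁆⇔ (cases z z∈p))
                      (λ z∈⁅x⁆∪⁅y⁆ → [ (λ { refl → x∈p }) , (λ { refl → y∈p }) ] (to x∈⁅y⁆∪⁅z⁆⇔ z∈⁅x⁆∪⁅y⁆))

∣p∪q∣≤∣p∣+∣q∣ : ∀ (p q : Subset n) → ∣ p ∪ q ∣ ≤ ∣ p ∣ + ∣ q ∣
∣p∪q∣≤∣p∣+∣q∣ []            []            = z≤n
∣p∪q∣≤∣p∣+∣q∣ (outside ∷ p) (outside ∷ q) = ∣p∪q∣≤∣p∣+∣q∣ p q
∣p∪q∣≤∣p∣+∣q∣ (outside ∷ p) (inside ∷ q)  = ≤-trans (s≤s (∣p∪q∣≤∣p∣+∣q∣ p q)) (≤-reflexive (sym (+-suc ∣ p ∣ ∣ q ∣)))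
∣p∪q∣≤∣p∣+∣q∣ (inside ∷ p)  (outside ∷ q) = s≤s (∣p∪q∣≤∣p∣+∣q∣ p q)
∣p∪q∣≤∣p∣+∣q∣ (inside ∷ p)  (inside ∷ q)  = s≤s (≤-trans (∣p∪q∣≤∣p∣+∣q∣ p q) (+-monoʳ-≤ ∣ p ∣ (n≤1+n ∣ q ∣)))

subsetOfSize : k ≤ ∣ p ∣ → ∃[ q ] q ⊆ p × ∣ q ∣ ≡ k
subsetOfSize {k = zero} {p = []} _ = [] , (λ ()) , refl
subsetOfSize {k = k} {p = outside ∷ p} k≤∣p∣ with subsetOfSize k≤∣p∣
... | q , q⊆p , ∣q∣≡k = outside ∷ q , (λ { (there x∈q) → there (q⊆p x∈q) }) , ∣q∣≡k
subsetOfSize {k = zero} {p = inside ∷ p} _ with subsetOfSize {p = p} z≤n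
... | q , q⊆p , ∣q∣≡0 = outside ∷ q , (λ { (there x∈q) → there (q⊆p x∈q) }) , ∣q∣≡0
subsetOfSize {k = suc k} {p = inside ∷ p} (s≤s k≤∣p∣) with subsetOfSize k≤∣p∣
... | q , q⊆p , ∣q∣≡k = inside ∷ q , (λ { here → here ; (there x∈q) → there (q⊆p x∈q) }) , cong suc ∣q∣≡k

Any-meets⇒meets-⋃ : ∀ {ps : List (Subset n)} → Any (λ q → Nonempty (p ∩ q)) ps → Nonempty (p ∩ ⋃ ps)
Any-meets⇒meets-⋃ {p = p} {q ∷ ps} (here (x , x∈p∩q)) with x∈p∩q⁻ p q x∈p∩q
... | x∈p , x∈q = x , x∈p∩q⁺ (x∈p , p⊆p∪q (⋃ ps) x∈q)
Any-meets⇒meets-⋃ {p = p} {q ∷ ps} (there meets) with Any-meets⇒meets-⋃ meets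
... | x , x∈p∩⋃ps with x∈p∩q⁻ p (⋃ ps) x∈p∩⋃ps
... | x∈p , x∈⋃ps = x , x∈p∩q⁺ (x∈p , q⊆p∪q q (⋃ ps) x∈⋃ps)

Dominates : ∀ {n} (G : SimpleGraph n) (k : ℕ) → TokenVertex n k → TokenVertex n k → Set
Dominates G k Y X = proj₁ X ≡ proj₁ Y ⊎ TokenAdj G k Y X

common-vertex⇒adjacent : ∀ {w} {c c′} → x ≢ w → y ≢ w → x ≢ y →
                         TokenAdj (complete n) 2 (⁅ w ⁆ ∪ ⁅ y ⁆ , c) (⁅ w ⁆ ∪ ⁅ x ⁆ , c′)
common-vertex⇒adjacent {x = x} {y = y} {w = w} x≢w y≢w x≢y =
  y , x , x≢y ∘ sym , second , ∉pair y≢w (x≢y ∘ sym) , second , ∉pair x≢w x≢y , λ z z≢y z≢x →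
    mk⇔ (replace-second z≢y) (replace-second z≢x)
  where
  second : ∀ {a} → a ∈ ⁅ w ⁆ ∪ ⁅ a ⁆
  second = from x∈⁅y⁆∪⁅z⁆⇔ (inj₂ refl)
  ∉pair : ∀ {a b c} → a ≢ b → a ≢ c → a ∉ ⁅ b ⁆ ∪ ⁅ c ⁆
  ∉pair a≢b a≢c = [ a≢b , a≢c ] ∘ to x∈⁅y⁆∪⁅z⁆⇔
  replace-second : ∀ {z a b} → z ≢ a → z ∈ ⁅ w ⁆ ∪ ⁅ a ⁆ → z ∈ ⁅ w ⁆ ∪ ⁅ b ⁆
  replace-second z≢a z∈ = from x∈⁅y⁆∪⁅z⁆⇔ (inj₁ ([ id , ⊥-elim ∘ z≢a ] (to x∈⁅y⁆∪⁅z⁆⇔ z∈)))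

meets⇒dominates : ∀ (X Y : TokenVertex n 2) → Nonempty (proj₁ X ∩ proj₁ Y) → Dominates (complete n) 2 Y X
meets⇒dominates (A , ∣A∣≡2) (B , ∣B∣≡2) (w , w∈A∩B) with x∈p∩q⁻ A B w∈A∩B
... | w∈A , w∈B with ∣p∣≡2⇒p≡⁅x⁆∪⁅y⁆ ∣A∣≡2 w∈A | ∣p∣≡2⇒p≡⁅x⁆∪⁅y⁆ ∣B∣≡2 w∈B
... | x , x≢w , refl | y , y≢w , refl with x ≟ y
... | yes refl = inj₁ refl
... | no x≢y   = inj₂ (common-vertex⇒adjacent {c = ∣B∣≡2} {∣A∣≡2} x≢w y≢w x≢y)

dominates⇒meets : ∀ (X Y : TokenVertex n 2) → Dominates (complete n) 2 Y X → Nonempty (proj₁ X ∩ proj₁ Y)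
dominates⇒meets (A , ∣A∣≡2) _ (inj₁ refl) with 0<∣p∣⇒Nonempty (subst (0 <_) (sym ∣A∣≡2) (s≤s z≤n))
... | x , x∈A = x , x∈p∩q⁺ (x∈A , x∈A)
dominates⇒meets (A , ∣A∣≡2) _ (inj₂ (u , v , _ , _ , u∉A , v∈A , _ , same)) with ∣p∣≡2⇒other ∣A∣≡2 v∈A
... | x , x≢v , x∈A , _ = x , x∈p∩q⁺ (x∈A , from (same x (λ { refl → u∉A x∈A }) x≢v) x∈A)

matching : (n : ℕ) → List (TokenVertex n 2)
matching zero          = []
matching (suc zero)    = []
matching (suc (suc n)) = (inside ∷ inside ∷ ⊥ , cong (2 +_) (∣⊥∣≡0 n)) ∷ map shift (matching n)
  where
  shift : TokenVertex n 2 → TokenVertex (suc (suc n)) 2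
  shift (A , ∣A∣≡2) = outside ∷ outside ∷ A , ∣A∣≡2

length-matching : ∀ n → length (matching n) ≡ n / 2
length-matching zero          = refl
length-matching (suc zero)    = refl
length-matching (suc (suc n)) = trans (cong suc (trans (length-map _ (matching n)) (length-matching n)))
                                      (sym (m/n≡1+[m∸n]/n {suc (suc n)} {2} (s≤s (s≤s z≤n))))

matching-meets : ∀ n (p : Subset n) → 2 ≤ ∣ p ∣ → Any (λ Y → Nonempty (p ∩ proj₁ Y)) (matching n)
matching-meets zero          p 2≤∣p∣ = contradiction (≤-trans 2≤∣p∣ (∣p∣≤n p)) λ ()
matching-meets (suc zero)    p 2≤∣p∣ = contradiction (≤-trans 2≤∣p∣ (∣p∣≤n p)) λ { (s≤s ()) }
matching-meets (suc (suc n)) (inside ∷ _)           _ = here (zero , here)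
matching-meets (suc (suc n)) (outside ∷ inside ∷ _) _ = here (suc zero , there here)
matching-meets (suc (suc n)) (outside ∷ outside ∷ p) 2≤∣p∣ =
  there (map⁺ (Any.map (λ { (x , x∈p∩q) → suc (suc x) , there (there x∈p∩q) }) (matching-meets n p 2≤∣p∣)))

matching-dominating : ∀ n → Dominating (complete n) 2 (matching n)
matching-dominating n X@(A , ∣A∣≡2) =
  Any.map (λ {Y} → meets⇒dominates X Y) (matching-meets n A (≤-reflexive (sym ∣A∣≡2)))

∣⋃∣≤k*length : ∀ (D : List (TokenVertex n k)) → ∣ ⋃ (map proj₁ D) ∣ ≤ k * length D
∣⋃∣≤k*length {n = n} {k = k} []  = ≤-trans (≤-reflexive (∣⊥∣≡0 n)) z≤n
∣⋃∣≤k*length {k = k} ((A , ∣A∣≡k) ∷ D) = begin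
  ∣ A ∪ ⋃ (map proj₁ D) ∣          ≤⟨ ∣p∪q∣≤∣p∣+∣q∣ A (⋃ (map proj₁ D)) ⟩
  ∣ A ∣ + ∣ ⋃ (map proj₁ D) ∣      ≤⟨ +-mono-≤ (≤-reflexive ∣A∣≡k) (∣⋃∣≤k*length D) ⟩
  k + k * length D                 ≡⟨ sym (*-suc k (length D)) ⟩
  k * suc (length D)               ∎
  where open ℕ.≤-Reasoning

dominating⇒meets-⋃ : ∀ (D : List (TokenVertex n 2)) → Dominating (complete n) 2 D →
                     ∀ (X : TokenVertex n 2) → Nonempty (proj₁ X ∩ ⋃ (map proj₁ D))
dominating⇒meets-⋃ D dom X = Any-meets⇒meets-⋃ (map⁺ (Any.map (λ {Y} → dominates⇒meets X Y) (dom X)))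

dominating⇒n≤1+∣⋃∣ : ∀ (D : List (TokenVertex n 2)) → Dominating (complete n) 2 D → n ≤ suc ∣ ⋃ (map proj₁ D) ∣
dominating⇒n≤1+∣⋃∣ {n = n} D dom = ≮⇒≥ undominated
  where
  U = ⋃ (map proj₁ D)
  undominated : ¬ suc ∣ U ∣ < n
  undominated 1+∣U∣<n with subsetOfSize (subst (2 ≤_) (sym (∣∁p∣≡n∸∣p∣ U)) (m+n≤o⇒m≤o∸n 2 1+∣U∣<n))
  ... | X , X⊆∁U , ∣X∣≡2 with dominating⇒meets-⋃ D dom (X , ∣X∣≡2)
  ... | x , x∈X∩U with x∈p∩q⁻ X U x∈X∩U
  ... | x∈X , x∈U = x∈∁p⇒x∉p (X⊆∁U x∈X) x∈U

n≤1+2m⇒n/2≤m : ∀ {n m} → n ≤ suc (2 * m) → n / 2 ≤ m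
n≤1+2m⇒n/2≤m {n} {m} n≤1+2m = s≤s⁻¹ (m<n*o⇒m/o<n (s≤s (subst (λ t → n ≤ suc t) (*-comm 2 m) n≤1+2m)))

dominating⇒n/2≤length : ∀ (D : List (TokenVertex n 2)) → Dominating (complete n) 2 D → n / 2 ≤ length D
dominating⇒n/2≤length D dom = n≤1+2m⇒n/2≤m (≤-trans (dominating⇒n≤1+∣⋃∣ D dom) (s≤s (∣⋃∣≤k*length D)))

-- The hypothesis 3 ≤ n is unused: the equality also holds for n ≤ 2.
proposition4p1 : (n : ℕ) → 3 ≤ n → DominationNumberIs (complete n) 2 (n / 2)
proposition4p1 n _ = (matching n , matching-dominating n , length-matching n) , dominating⇒n/2≤length
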